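{- Let $G$ be a graph with VC-dimension one. If $a_1,a_2,a_3$ are the vertices of a triangle in $G$, then every vertex in $V(G)\setminus\{a_1,a_2,a_3\}$ is adjacent to at least two vertices of $\{a_1,a_2,a_3\}$.
   Context: The VC-dimension of a graph $G$ is the largest $d$ such that some $S\subseteq V(G)$ with $|S|=d$ satisfies: for every $B\subseteq S$ there is a vertex $v$ with $N_G(v)\cap S=B$. -}

module Defs where

open import Data.Nat using (ℕ; _≤_)
open import Data.Bool using (Bool; true; false)
open import Data.Fin using (Fin)
open import Data.Fin.Subset using (Subset; _∈_; _⊆_; ∣_∣)
open import Data.Product using (Σ; ∃; _×_; _,_)
open import Relation.Binary.PropositionalEquality using (_≡_)
open import Relation.Nullary using (¬_)

record Graph (n : ℕ) : Set where
  field
    adj   : Fin n → Fin n → Bool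
    sym   : ∀ u v → adj u v ≡ adj v u
    irrefl : ∀ v → adj v v ≡ false

open Graph public

_~[_]_ : {n : ℕ} → Fin n → Graph n → Fin n → Set
u ~[ G ] v = adj G u v ≡ true

Shattered : {n : ℕ} → Graph n → Subset n → Set
Shattered {n} G S =
  (B : Subset n) → B ⊆ S →
  Σ (Fin n) λ v → (x : Fin n) → x ∈ S →
    ((v ~[ G ] x → x ∈ B) × (x ∈ B → v ~[ G ] x))

HasVCdim : {n : ℕ} → Graph n → ℕ → Set
HasVCdim {n} G d =
  (Σ (Subset n) λ S → (∣ S ∣ ≡ d) × Shattered G S)
  × ((S : Subset n) → Shattered G S → ∣ S ∣ ≤ d)

{-# OPTIONS --safe #-}
module Submission where

-- If v is adjacent to neither x nor y, where xy is an edge of a triangle xyw,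
-- then {x, y} is shattered: its four subsets ∅, {x}, {y}, {x, y} are cut out
-- by the neighbourhoods of v, y, x and w respectively (there are no loops).
-- A shattered pair contradicts VC-dimension one.

open import Defs hiding (sym)
open import Data.Nat using (ℕ; _<_)
open import Data.Nat.Properties using (<⇒≱)
open import Data.Bool using (Bool; true; false)
open import Data.Fin using (Fin)
open import Data.Fin.Subset using (Subset; _∈_; _∪_; ⁅_⁆; ∣_∣)
open import Data.Fin.Subset.Properties
  using (x∈⁅x⁆; x∈⁅y⁆⇒x≡y; ∣⁅x⁆∣≡1; p⊆p∪q; q⊆p∪q; x∈p∪q⁻; p⊂q⇒∣p∣<∣q∣)
open import Data.Vec using (lookup)
open import Data.Vec.Properties using ([]=⇒lookup; lookup⇒[]=)
open import Data.Sum using (_⊎_; inj₁; inj₂)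
open import Data.Product using (∃; _×_; _,_)
open import Data.Empty using (⊥; ⊥-elim)
open import Function using (_∘_)
open import Relation.Binary.PropositionalEquality using (_≡_; _≢_; refl; sym; trans; subst)
open import Relation.Nullary using (¬_)

∣⁅x⁆∪⁅y⁆∣>1 : {n : ℕ} {x y : Fin n} → x ≢ y → 1 < ∣ ⁅ x ⁆ ∪ ⁅ y ⁆ ∣
∣⁅x⁆∪⁅y⁆∣>1 {x = x} {y} x≢y =
  subst (_< ∣ ⁅ x ⁆ ∪ ⁅ y ⁆ ∣) (∣⁅x⁆∣≡1 x)
    (p⊂q⇒∣p∣<∣q∣ ( p⊆p∪q ⁅ y ⁆
                 , y , q⊆p∪q ⁅ x ⁆ ⁅ y ⁆ (x∈⁅x⁆ y) , x≢y ∘ sym ∘ x∈⁅y⁆⇒x≡y x))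

module _ {n : ℕ} (G : Graph n) where

  ~-sym : {u v : Fin n} → u ~[ G ] v → v ~[ G ] u
  ~-sym {u} {v} u~v = trans (Graph.sym G v u) u~v

  ~⇒≢ : {u v : Fin n} → u ~[ G ] v → u ≢ v
  ~⇒≢ {u} u~v refl with trans (sym u~v) (irrefl G u)
  ... | ()

  adj≡lookup⇒⇔∈ : {u z : Fin n} (B : Subset n) → adj G u z ≡ lookup B z →
                  (u ~[ G ] z → z ∈ B) × (z ∈ B → u ~[ G ] z)
  adj≡lookup⇒⇔∈ {z = z} B e =
    (λ u~z → lookup⇒[]= z B (trans (sym e) u~z)) , (λ z∈B → trans e ([]=⇒lookup z∈B))

  pair-shattered : {x y : Fin n} →
                   ((b c : Bool) → ∃ λ u → adj G u x ≡ b × adj G u y ≡ c) →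
                   Shattered G (⁅ x ⁆ ∪ ⁅ y ⁆)
  pair-shattered {x} {y} realise B _ with realise (lookup B x) (lookup B y)
  ... | u , ux , uy = u , realised
    where
    realised : (z : Fin n) → z ∈ ⁅ x ⁆ ∪ ⁅ y ⁆ →
               (u ~[ G ] z → z ∈ B) × (z ∈ B → u ~[ G ] z)
    realised z z∈S with x∈p∪q⁻ ⁅ x ⁆ ⁅ y ⁆ z∈S
    ... | inj₁ z∈⁅x⁆ rewrite x∈⁅y⁆⇒x≡y x z∈⁅x⁆ = adj≡lookup⇒⇔∈ B ux
    ... | inj₂ z∈⁅y⁆ rewrite x∈⁅y⁆⇒x≡y y z∈⁅y⁆ = adj≡lookup⇒⇔∈ B uy

  triangle-edge-shattered : {x y w v : Fin n} →
                            x ~[ G ] y → w ~[ G ] x → w ~[ G ] y →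
                            adj G v x ≡ false → adj G v y ≡ false →
                            Shattered G (⁅ x ⁆ ∪ ⁅ y ⁆)
  triangle-edge-shattered {x} {y} {w} {v} x~y w~x w~y v≁x v≁y = pair-shattered realise
    where
    realise : (b c : Bool) → ∃ λ u → adj G u x ≡ b × adj G u y ≡ c
    realise false false = v , v≁x , v≁y
    realise true  false = y , ~-sym x~y , irrefl G y
    realise false true  = x , irrefl G x , x~y
    realise true  true  = w , w~x , w~y

  VCdim1⇒no-common-non-neighbour : HasVCdim G 1 → {x y w v : Fin n} →
                                   x ~[ G ] y → w ~[ G ] x → w ~[ G ] y →
                                   adj G v x ≡ false → adj G v y ≡ false → ⊥
  VCdim1⇒no-common-non-neighbour (_ , shattered≤1) x~y w~x w~y v≁x v≁y =
    <⇒≱ (∣⁅x⁆∪⁅y⁆∣>1 (~⇒≢ x~y))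
        (shattered≤1 _ (triangle-edge-shattered x~y w~x w~y v≁x v≁y))

lemma2p3 : {n : ℕ} (G : Graph n) → HasVCdim G 1 →
    (a₁ a₂ a₃ : Fin n) →
    a₁ ~[ G ] a₂ → a₂ ~[ G ] a₃ → a₁ ~[ G ] a₃ →
    (v : Fin n) → ¬ v ≡ a₁ → ¬ v ≡ a₂ → ¬ v ≡ a₃ →
    (v ~[ G ] a₁ × v ~[ G ] a₂) ⊎ (v ~[ G ] a₁ × v ~[ G ] a₃)
      ⊎ (v ~[ G ] a₂ × v ~[ G ] a₃)
lemma2p3 G vc a₁ a₂ a₃ a₁~a₂ a₂~a₃ a₁~a₃ v _ _ _
  with adj G v a₁ in v₁ | adj G v a₂ in v₂ | adj G v a₃ in v₃
... | true  | true  | _     = inj₁ (refl , refl)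
... | true  | false | true  = inj₂ (inj₁ (refl , refl))
... | false | true  | true  = inj₂ (inj₂ (refl , refl))
... | _     | false | false =
  ⊥-elim (VCdim1⇒no-common-non-neighbour G vc a₂~a₃ a₁~a₂ a₁~a₃ v₂ v₃)
... | false | _     | false =
  ⊥-elim (VCdim1⇒no-common-non-neighbour G vc a₁~a₃ (~-sym G a₁~a₂) a₂~a₃ v₁ v₃)
... | false | false | _     =
  ⊥-elim (VCdim1⇒no-common-non-neighbour G vc a₁~a₂ (~-sym G a₁~a₃) (~-sym G a₂~a₃) v₁ v₂)
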